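{- Let $A$ be a set and $\mathcal{T}$ a predicate on $(A\times\mathbb{B})^*$. Reading the logical connectives classically (or linearly), the following are equivalent: (a) $\mathsf{GDC}_{A\mathbb{B}\mathcal{T}^C}$: if $\mathcal{T}^C$ is $A$-$\mathbb{B}$-approximable then $\mathcal{T}^C$ has an $A$-$\mathbb{B}$-choice function; (b) $\mathsf{BPF}_{\mathrm{Free}(A)}(F_{\mathcal{T}})$: if the filter $F_{\mathcal{T}}$ of $\mathrm{Free}(A)$ is proper then it is contained in a prime filter of $\mathrm{Free}(A)$; (c) $\mathsf{BPI}_{\mathrm{Free}(A)}(I_{\mathcal{T}})$: if the ideal $I_{\mathcal{T}}$ of $\mathrm{Free}(A)$ is proper then it is contained in a prime ideal of $\mathrm{Free}(A)$.
   Context: $\mathbb{B}=\{0,1\}$. $(A\times\mathbb{B})^*$ is the set of finite sequences $v$ of pairs; $v\subseteq v'$ means every pair in $v$ occurs in $v'$; $\mathrm{dom}(v)$ is the set of first components in $v$; $T^{\downarrow}=\{v\mid\forall v'\subseteq v,\ v'\in T\}$. A sequence $v$ is read as a clause $\Gamma\triangleright\Delta$ with $\Gamma=\{a\mid(a,1)\in v\}$, $\Delta=\{a\mid(a,0)\in v\}$. $\mathcal{T}^C$ is the complement of $\mathcal{T}$. $T$ is $A$-$\mathbb{B}$-approximable if $\langle\rangle$ belongs to the greatest $X$ such that $X(v)$ implies $v\in T^{\downarrow}$ and $\forall a\notin\mathrm{dom}(v)\,\exists b\,X(v\star(a,b))$. For $\alpha:A\to\mathbb{B}$, $v\prec\alpha$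 means $\alpha(a)=b$ for all $(a,b)$ in $v$; $T$ has an $A$-$\mathbb{B}$-choice function if $\exists\alpha\,\forall v\,(v\prec\alpha\Rightarrow v\in T)$. The entailment relation $\vdash_{\mathcal{T}}$ on pairs of finite sets of atoms is the least relation such that $\Gamma\vdash_{\mathcal{T}}\Delta$ holds if $\Gamma\cap\Delta\neq\emptyset$, or if some clause $\Gamma'\triangleright\Delta'$ of $\mathcal{T}$ has $\Gamma'\subseteq\Gamma,\Delta'\subseteq\Delta$, or if $\Gamma\vdash_{\mathcal{T}}\Delta,F$ and $\Gamma,F\vdash_{\mathcal{T}}\Delta$ for some atom $F$. $\mathrm{Free}(A)$ is the free Boolean algebra $(\dot\vee,\dot\wedge,\dot\bot,\dot\top,\dot\neg)$ generated by $A$, with order $x\leq y$ iff $x\dot\wedge y=x$. $F_{\mathcal{T}}$ is the set of elements of the form $\dot\bigwedge_i\big((\dot\bigvee\dot\neg\Gamma_i)\,\dot\vee\,(\dot\bigvee\Delta_i)\big)$ with $\Gamma_i\vdash_{\mathcal{T}}\Delta_i$ for all $i$; $I_{\mathcal{T}}$ is the set of elements of the form $\dot\bigvee_i\big((\dot\bigwedge\Gamma_i)\,\dot\wedge\,(\dot\bigwedge\dot\neg\Delta_i)\big)$ with $\Gamma_i\vdash_{\mathcal{T}}\Delta_i$ for all $i$ (these are a filter and an ideal respectively). A filter is a non-empty subset closed under $\dot\wedge$ and upward closed; it is proper if it does not contain $\dot\bot$ and prime if $x\dot\vee y\in F$ implies $x\in F$ or $y\in F$. An ideal is a non-empty subset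 closed under $\dot\vee$ and downward closed; proper if it does not contain $\dot\top$; prime if $x\dot\wedge y\in I$ implies $x\in I$ or $y\in I$. -}

module Defs where

open import Level using (Level; 0ℓ) renaming (suc to lsuc)
open import Data.Bool using (Bool; true; false)
open import Data.List using (List; []; _∷_; _++_; [_]; foldr; map)
open import Data.List.Membership.Propositional using (_∈_)
open import Data.List.Relation.Unary.All using (All)
open import Data.Product using (Σ; proj₁; _×_; _,_; ∃; ∃-syntax)
open import Data.Sum using (_⊎_)
open import Relation.Nullary using (¬_)
open import Relation.Binary.PropositionalEquality using (_≡_)

Seq : Set → Set
Seq A = List (A × Bool)

_⊆ₛ_ : {A : Set} → Seq A → Seq A → Set
v ⊆ₛ v' = ∀ {p} → p ∈ v → p ∈ v'

_∈dom_ : {A : Set} → A → Seq A → Set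
a ∈dom v = ∃[ b ] ((a , b) ∈ v)

_ᶜ : {A : Set} → (Seq A → Set) → (Seq A → Set)
(T ᶜ) v = ¬ T v

_↓ : {A : Set} → (Seq A → Set) → (Seq A → Set)
(T ↓) v = ∀ v' → v' ⊆ₛ v → T v'

-- X is a post-fixed point of the operator defining approximability
PostFixed : {A : Set} → (Seq A → Set) → (Seq A → Set) → Set
PostFixed {A} T X =
  ∀ v → X v → (T ↓) v × (∀ (a : A) → ¬ (a ∈dom v) → ∃[ b ] X (v ++ [ (a , b) ]))

-- ⟨⟩ belongs to the greatest such X, i.e. (Knaster–Tarski: the greatest
-- fixed point is the union of all post-fixed points) ⟨⟩ lies in some
-- post-fixed point.
Approximable : {A : Set} → (Seq A → Set) → Set₁
Approximable T = ∃[ X ] (PostFixed T X × X [])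

_≺_ : {A : Set} → Seq A → (A → Bool) → Set
v ≺ α = All (λ { (a , b) → α a ≡ b }) v

HasChoiceFunction : {A : Set} → (Seq A → Set) → Set
HasChoiceFunction {A} T = ∃[ α ] (∀ (v : Seq A) → v ≺ α → T v)

GDC : {A : Set} → (Seq A → Set) → Set₁
GDC T = Approximable T → HasChoiceFunction T

data Entails {A : Set} (T : Seq A → Set) : List A → List A → Set where
  ⊢refl : ∀ {Γ Δ a} → a ∈ Γ → a ∈ Δ → Entails T Γ Δ
  ⊢ax   : ∀ {Γ Δ} (v : Seq A) → T v →
          (∀ a → (a , true) ∈ v → a ∈ Γ) →
          (∀ a → (a , false) ∈ v → a ∈ Δ) → Entails T Γ Δ
  ⊢cut  : ∀ {Γ Δ} (F : A) → Entails T Γ (F ∷ Δ) → Entails T (F ∷ Γ) Δ →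
          Entails T Γ Δ

-- The free Boolean algebra Free(A): terms modulo the least congruence
-- generated by the Boolean algebra axioms.

infixr 6 _∧̇_
infixr 5 _∨̇_

data Term (A : Set) : Set where
  var  : A → Term A
  _∨̇_  : Term A → Term A → Term A
  _∧̇_  : Term A → Term A → Term A
  ⊥̇ ⊤̇ : Term A
  ¬̇_   : Term A → Term A

infix 4 _≈_
data _≈_ {A : Set} : Term A → Term A → Set where
  ≈refl  : ∀ {x} → x ≈ x
  ≈sym   : ∀ {x y} → x ≈ y → y ≈ x
  ≈trans : ∀ {x y z} → x ≈ y → y ≈ z → x ≈ z
  ∨-cong : ∀ {x x' y y'} → x ≈ x' → y ≈ y' → (x ∨̇ y) ≈ (x' ∨̇ y')
  ∧-cong : ∀ {x x' y y'} → x ≈ x' → y ≈ y' → (x ∧̇ y) ≈ (x' ∧̇ y')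
  ¬-cong : ∀ {x x'} → x ≈ x' → (¬̇ x) ≈ (¬̇ x')
  ∨-assoc : ∀ x y z → ((x ∨̇ y) ∨̇ z) ≈ (x ∨̇ (y ∨̇ z))
  ∧-assoc : ∀ x y z → ((x ∧̇ y) ∧̇ z) ≈ (x ∧̇ (y ∧̇ z))
  ∨-comm  : ∀ x y → (x ∨̇ y) ≈ (y ∨̇ x)
  ∧-comm  : ∀ x y → (x ∧̇ y) ≈ (y ∧̇ x)
  ∨-absorbs-∧ : ∀ x y → (x ∨̇ (x ∧̇ y)) ≈ x
  ∧-absorbs-∨ : ∀ x y → (x ∧̇ (x ∨̇ y)) ≈ x
  ∨-distrib-∧ : ∀ x y z → (x ∨̇ (y ∧̇ z)) ≈ ((x ∨̇ y) ∧̇ (x ∨̇ z))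
  ∧-distrib-∨ : ∀ x y z → (x ∧̇ (y ∨̇ z)) ≈ ((x ∧̇ y) ∨̇ (x ∧̇ z))
  ∨-identity : ∀ x → (x ∨̇ ⊥̇) ≈ x
  ∧-identity : ∀ x → (x ∧̇ ⊤̇) ≈ x
  ∨-complement : ∀ x → (x ∨̇ (¬̇ x)) ≈ ⊤̇
  ∧-complement : ∀ x → (x ∧̇ (¬̇ x)) ≈ ⊥̇

_≤̇_ : {A : Set} → Term A → Term A → Set
x ≤̇ y = (x ∧̇ y) ≈ x

⋁̇ : {A : Set} → List (Term A) → Term A
⋁̇ = foldr _∨̇_ ⊥̇

⋀̇ : {A : Set} → List (Term A) → Term A
⋀̇ = foldr _∧̇_ ⊤̇

Entailments : {A : Set} → (Seq A → Set) → Set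
Entailments {A} T = List (Σ (List A × List A) λ { (Γ , Δ) → Entails T Γ Δ })

clauseF : {A : Set} → List A × List A → Term A
clauseF (Γ , Δ) = ⋁̇ (map (λ a → ¬̇ var a) Γ) ∨̇ ⋁̇ (map var Δ)

clauseI : {A : Set} → List A × List A → Term A
clauseI (Γ , Δ) = ⋀̇ (map var Γ) ∧̇ ⋀̇ (map (λ a → ¬̇ var a) Δ)

F[_] : {A : Set} → (Seq A → Set) → Term A → Set
F[_] {A} T x = Σ (Entailments T) λ es → x ≈ ⋀̇ (map (λ e → clauseF (proj₁ e)) es)

I[_] : {A : Set} → (Seq A → Set) → Term A → Set
I[_] {A} T x = Σ (Entailments T) λ es → x ≈ ⋁̇ (map (λ e → clauseI (proj₁ e)) es)

record IsFilter {A : Set} (P : Term A → Set) : Set where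
  field
    nonempty : ∃[ x ] P x
    ∧-closed : ∀ {x y} → P x → P y → P (x ∧̇ y)
    up-closed : ∀ {x y} → x ≤̇ y → P x → P y

record IsIdeal {A : Set} (P : Term A → Set) : Set where
  field
    nonempty : ∃[ x ] P x
    ∨-closed : ∀ {x y} → P x → P y → P (x ∨̇ y)
    down-closed : ∀ {x y} → x ≤̇ y → P y → P x

ProperFilter : {A : Set} → (Term A → Set) → Set
ProperFilter P = ¬ P ⊥̇

ProperIdeal : {A : Set} → (Term A → Set) → Set
ProperIdeal P = ¬ P ⊤̇

PrimeFilter : {A : Set} → (Term A → Set) → Set
PrimeFilter P = ∀ {x y} → P (x ∨̇ y) → P x ⊎ P y

PrimeIdeal : {A : Set} → (Term A → Set) → Set
PrimeIdeal P = ∀ {x y} → P (x ∧̇ y) → P x ⊎ P y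

_⊆ₜ_ : {A : Set} → (Term A → Set) → (Term A → Set) → Set
P ⊆ₜ Q = ∀ x → P x → Q x

BPF : {A : Set} → (Term A → Set) → Set₁
BPF {A} F = ProperFilter F →
  ∃[ P ] (IsFilter P × ProperFilter P × PrimeFilter P × F ⊆ₜ P)

BPI : {A : Set} → (Term A → Set) → Set₁
BPI {A} I = ProperIdeal I →
  ∃[ P ] (IsIdeal P × ProperIdeal P × PrimeIdeal P × I ⊆ₜ P)

-- Classically all three statements say that T has a Boolean model.  A choice
-- function α for Tᶜ validates every entailment Γ ⊢_T Δ, so the terms true
-- under α form a prime filter containing F_T and the terms false under α a
-- prime ideal containing I_T; conversely a prime filter P (prime ideal I)
-- containing F_T (I_T) yields the choice function a ↦ [var a ∈ P]
-- (a ↦ [var a ∉ I]).  The hypotheses of the three principles all amount to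
-- ∅ ⊬_T ∅.  The sequences whose clause Γ ▹ Δ has Γ ⊬_T Δ form a post-fixed
-- point thanks to cut; conversely finitely many entailments are validated by
-- the valuation read off a long enough node of an approximation, because a
-- cut on an atom not yet decided at a node is settled by extending the node.
module Submission where

open import Defs
open import Level using (0ℓ; lift; lower)
open import Data.Bool using (Bool; true; false; not; _∧_; _∨_)
import Data.Bool.Properties as Bool
open import Data.Product as Product using (_×_; _,_; proj₁; proj₂; ∃-syntax)
open import Data.Sum as Sum using (_⊎_; inj₁; inj₂)
open import Data.Empty using (⊥)
open import Data.List using (List; []; _∷_; _++_; [_]; map)
open import Data.List.Relation.Unary.Any using (Any; here; there)
import Data.List.Relation.Unary.Any.Properties as Any
open import Data.List.Relation.Unary.All as All using (All; []; _∷_)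
import Data.List.Relation.Unary.All.Properties as All
open import Data.List.Membership.Propositional using (_∈_)
open import Data.List.Membership.Propositional.Properties
  using (∈-++⁺ˡ; ∈-++⁺ʳ; ∈-++⁻)
open import Data.List.Relation.Binary.Subset.Propositional using (_⊆_)
open import Data.List.Relation.Binary.Subset.Propositional.Properties
  using (⊆-trans; ∈-∷⁺ʳ; ⊆-reflexive-↭; xs⊆xs++ys; xs⊆ys++xs)
open import Data.List.Relation.Binary.Permutation.Propositional using (↭-sym)
open import Data.List.Relation.Binary.Permutation.Propositional.Properties using (∷↭∷ʳ)
open import Relation.Nullary using (¬_; Dec; yes; no; does)
open import Relation.Nullary.Decidable using (map′)
open import Relation.Binary.PropositionalEquality using (_≡_; refl; sym; trans; cong; cong₂)
open import Function using (_∘_)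
open import Function.Bundles using (_⇔_; mk⇔)
open import Axiom.ExcludedMiddle using (ExcludedMiddle)

private variable
  A : Set
  T : Seq A → Set
  α : A → Bool
  a : A
  b : Bool
  x y : Term A
  xs : List (Term A)
  Γ Δ : List A
  v w : Seq A

∨-≡true : ∀ p {q} → p ∨ q ≡ true → p ≡ true ⊎ q ≡ true
∨-≡true true  _  = inj₁ refl
∨-≡true false eq = inj₂ eq

∧-≡false : ∀ p {q} → p ∧ q ≡ false → p ≡ false ⊎ q ≡ false
∧-≡false false _  = inj₁ refl
∧-≡false true  eq = inj₂ eq

does-true : {P : Set} (P? : Dec P) → does P? ≡ true → P
does-true (yes p) _ = p
does-true (no _) ()

does-false : {P : Set} (P? : Dec P) → does P? ≡ false → ¬ P
does-false (no ¬p) _ = ¬p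
does-false (yes _) ()

⟦_⟧ : Term A → (A → Bool) → Bool
⟦ var a ⟧ α = α a
⟦ x ∨̇ y ⟧ α = ⟦ x ⟧ α ∨ ⟦ y ⟧ α
⟦ x ∧̇ y ⟧ α = ⟦ x ⟧ α ∧ ⟦ y ⟧ α
⟦ ⊥̇ ⟧ α = false
⟦ ⊤̇ ⟧ α = true
⟦ ¬̇ x ⟧ α = not (⟦ x ⟧ α)

⟦⟧-cong : (α : A → Bool) → x ≈ y → ⟦ x ⟧ α ≡ ⟦ y ⟧ α
⟦⟧-cong α ≈refl = refl
⟦⟧-cong α (≈sym p) = sym (⟦⟧-cong α p)
⟦⟧-cong α (≈trans p q) = trans (⟦⟧-cong α p) (⟦⟧-cong α q)
⟦⟧-cong α (∨-cong p q) = cong₂ _∨_ (⟦⟧-cong α p) (⟦⟧-cong α q)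
⟦⟧-cong α (∧-cong p q) = cong₂ _∧_ (⟦⟧-cong α p) (⟦⟧-cong α q)
⟦⟧-cong α (¬-cong p) = cong not (⟦⟧-cong α p)
⟦⟧-cong α (∨-assoc x y z) = Bool.∨-assoc (⟦ x ⟧ α) (⟦ y ⟧ α) (⟦ z ⟧ α)
⟦⟧-cong α (∧-assoc x y z) = Bool.∧-assoc (⟦ x ⟧ α) (⟦ y ⟧ α) (⟦ z ⟧ α)
⟦⟧-cong α (∨-comm x y) = Bool.∨-comm (⟦ x ⟧ α) (⟦ y ⟧ α)
⟦⟧-cong α (∧-comm x y) = Bool.∧-comm (⟦ x ⟧ α) (⟦ y ⟧ α)
⟦⟧-cong α (∨-absorbs-∧ x y) = Bool.∨-abs-∧ (⟦ x ⟧ α) (⟦ y ⟧ α)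
⟦⟧-cong α (∧-absorbs-∨ x y) = Bool.∧-abs-∨ (⟦ x ⟧ α) (⟦ y ⟧ α)
⟦⟧-cong α (∨-distrib-∧ x y z) =
  Bool.∨-distribˡ-∧ (⟦ x ⟧ α) (⟦ y ⟧ α) (⟦ z ⟧ α)
⟦⟧-cong α (∧-distrib-∨ x y z) =
  Bool.∧-distribˡ-∨ (⟦ x ⟧ α) (⟦ y ⟧ α) (⟦ z ⟧ α)
⟦⟧-cong α (∨-identity x) = Bool.∨-identityʳ (⟦ x ⟧ α)
⟦⟧-cong α (∧-identity x) = Bool.∧-identityʳ (⟦ x ⟧ α)
⟦⟧-cong α (∨-complement x) = Bool.∨-inverseʳ (⟦ x ⟧ α)
⟦⟧-cong α (∧-complement x) = Bool.∧-inverseʳ (⟦ x ⟧ α)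

⟦⋀̇⟧-true⁺ : All (λ x → ⟦ x ⟧ α ≡ true) xs → ⟦ ⋀̇ xs ⟧ α ≡ true
⟦⋀̇⟧-true⁺ [] = refl
⟦⋀̇⟧-true⁺ (p ∷ ps) = cong₂ _∧_ p (⟦⋀̇⟧-true⁺ ps)

⟦⋀̇⟧-true⁻ : ∀ xs → ⟦ ⋀̇ xs ⟧ α ≡ true → All (λ x → ⟦ x ⟧ α ≡ true) xs
⟦⋀̇⟧-true⁻ [] _ = []
⟦⋀̇⟧-true⁻ (x ∷ xs) p =
  Bool.∧-conicalˡ _ _ p ∷ ⟦⋀̇⟧-true⁻ xs (Bool.∧-conicalʳ _ _ p)

⟦⋁̇⟧-false⁺ : All (λ x → ⟦ x ⟧ α ≡ false) xs → ⟦ ⋁̇ xs ⟧ α ≡ false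
⟦⋁̇⟧-false⁺ [] = refl
⟦⋁̇⟧-false⁺ (p ∷ ps) = cong₂ _∨_ p (⟦⋁̇⟧-false⁺ ps)

⟦⋁̇⟧-false⁻ : ∀ xs → ⟦ ⋁̇ xs ⟧ α ≡ false → All (λ x → ⟦ x ⟧ α ≡ false) xs
⟦⋁̇⟧-false⁻ [] _ = []
⟦⋁̇⟧-false⁻ (x ∷ xs) p =
  Bool.∨-conicalˡ _ _ p ∷ ⟦⋁̇⟧-false⁻ xs (Bool.∨-conicalʳ _ _ p)

true-isFilter : (α : A → Bool) → IsFilter (λ x → ⟦ x ⟧ α ≡ true)
true-isFilter α = record
  { nonempty = ⊤̇ , refl
  ; ∧-closed = λ {x} {y} → cong₂ _∧_
  ; up-closed = λ {x} {y} x≤y p →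
      Bool.∧-conicalʳ (⟦ x ⟧ α) _ (trans (⟦⟧-cong α x≤y) p)
  }

false-isIdeal : (α : A → Bool) → IsIdeal (λ x → ⟦ x ⟧ α ≡ false)
false-isIdeal α = record
  { nonempty = ⊥̇ , refl
  ; ∨-closed = λ {x} {y} → cong₂ _∨_
  ; down-closed = λ {x} {y} x≤y p →
      trans (sym (⟦⟧-cong α x≤y)) (trans (cong (⟦ x ⟧ α ∧_) p) (Bool.∧-zeroʳ _))
  }

∧̇-idem : (x : Term A) → x ∧̇ x ≈ x
∧̇-idem x =
  ≈trans (∧-cong ≈refl (≈sym (∨-absorbs-∧ x ⊤̇))) (∧-absorbs-∨ x (x ∧̇ ⊤̇))

x∧̇¬̇x≤̇⊥̇ : (x : Term A) → (x ∧̇ ¬̇ x) ≤̇ ⊥̇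
x∧̇¬̇x≤̇⊥̇ x =
  ≈trans (∧-cong (∧-complement x) ≈refl) (≈trans (∧̇-idem ⊥̇) (≈sym (∧-complement x)))

⊤̇≤̇x∨̇¬̇x : (x : Term A) → ⊤̇ ≤̇ (x ∨̇ ¬̇ x)
⊤̇≤̇x∨̇¬̇x x = ≈trans (∧-cong ≈refl (∨-complement x)) (∧̇-idem ⊤̇)

filter-¬̇ : {P : Term A → Set} → IsFilter P → P x → P (¬̇ x) → P ⊥̇
filter-¬̇ {x = x} P-filter p ¬p = up-closed (x∧̇¬̇x≤̇⊥̇ x) (∧-closed p ¬p)
  where open IsFilter P-filter

ideal-¬̇ : {I : Term A → Set} → IsIdeal I → I x → I (¬̇ x) → I ⊤̇
ideal-¬̇ {x = x} I-ideal i ¬i = down-closed (⊤̇≤̇x∨̇¬̇x x) (∨-closed i ¬i)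
  where open IsIdeal I-ideal

prime-⋁̇ : {P : Term A → Set} → PrimeFilter P → ∀ xs → P (⋁̇ xs) → P ⊥̇ ⊎ Any P xs
prime-⋁̇ prime [] p = inj₁ p
prime-⋁̇ prime (x ∷ xs) p with prime p
... | inj₁ px = inj₂ (here px)
... | inj₂ pxs with prime-⋁̇ prime xs pxs
...   | inj₁ p⊥ = inj₁ p⊥
...   | inj₂ any = inj₂ (there any)

prime-⋀̇ : {I : Term A → Set} → PrimeIdeal I → ∀ xs → I (⋀̇ xs) → I ⊤̇ ⊎ Any I xs
prime-⋀̇ prime [] i = inj₁ i
prime-⋀̇ prime (x ∷ xs) i with prime i
... | inj₁ ix = inj₂ (here ix)
... | inj₂ ixs with prime-⋀̇ prime xs ixs
...   | inj₁ i⊤ = inj₁ i⊤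
...   | inj₂ any = inj₂ (there any)

prime-clauseF : {P : Term A → Set} → PrimeFilter P → ∀ Γ Δ → P (clauseF (Γ , Δ)) →
                P ⊥̇ ⊎ Any (λ a → P (¬̇ var a)) Γ ⊎ Any (λ a → P (var a)) Δ
prime-clauseF {P = P} prime Γ Δ p with prime {⋁̇ (map (λ a → ¬̇ var a) Γ)} {⋁̇ (map var Δ)} p
... | inj₁ p⁻ = Sum.map₂ (inj₁ ∘ Any.map⁻ {f = λ a → ¬̇ var a})
                        (prime-⋁̇ {P = P} prime (map (λ a → ¬̇ var a) Γ) p⁻)
... | inj₂ p⁺ = Sum.map₂ (inj₂ ∘ Any.map⁻ {f = var}) (prime-⋁̇ {P = P} prime (map var Δ) p⁺)

prime-clauseI : {I : Term A → Set} → PrimeIdeal I → ∀ Γ Δ → I (clauseI (Γ , Δ)) →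
                I ⊤̇ ⊎ Any (λ a → I (var a)) Γ ⊎ Any (λ a → I (¬̇ var a)) Δ
prime-clauseI {I = I} prime Γ Δ i with prime {⋀̇ (map var Γ)} {⋀̇ (map (λ a → ¬̇ var a) Δ)} i
... | inj₁ i⁺ = Sum.map₂ (inj₁ ∘ Any.map⁻ {f = var}) (prime-⋀̇ {I = I} prime (map var Γ) i⁺)
... | inj₂ i⁻ = Sum.map₂ (inj₂ ∘ Any.map⁻ {f = λ a → ¬̇ var a})
                        (prime-⋀̇ {I = I} prime (map (λ a → ¬̇ var a) Δ) i⁻)

Falsifies : (A → Bool) → List A × List A → Set
Falsifies α c = All (λ a → α a ≡ true) (proj₁ c) × All (λ a → α a ≡ false) (proj₂ c)

Satisfies : {T : Seq A → Set} → (A → Bool) → Entailments T → Set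
Satisfies α = All (λ e → ¬ Falsifies α (proj₁ e))

clauseF-false⇒falsifies : ∀ Γ Δ → ⟦ clauseF (Γ , Δ) ⟧ α ≡ false → Falsifies α (Γ , Δ)
clauseF-false⇒falsifies Γ Δ p =
  All.map Bool.not-injective (All.map⁻ (⟦⋁̇⟧-false⁻ _ (Bool.∨-conicalˡ _ _ p))) ,
  All.map⁻ (⟦⋁̇⟧-false⁻ _ (Bool.∨-conicalʳ _ _ p))

clauseI-true⇒falsifies : ∀ Γ Δ → ⟦ clauseI (Γ , Δ) ⟧ α ≡ true → Falsifies α (Γ , Δ)
clauseI-true⇒falsifies Γ Δ p =
  All.map⁻ (⟦⋀̇⟧-true⁻ _ (Bool.∧-conicalˡ _ _ p)) ,
  All.map Bool.not-injective (All.map⁻ (⟦⋀̇⟧-true⁻ _ (Bool.∧-conicalʳ _ _ p)))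

F-member-true : (es : Entailments T) → Satisfies α es →
                x ≈ ⋀̇ (map (λ e → clauseF (proj₁ e)) es) → ⟦ x ⟧ α ≡ true
F-member-true {α = α} es sat x≈ =
  trans (⟦⟧-cong α x≈) (⟦⋀̇⟧-true⁺ (All.map⁺ (All.map clauseF-true sat)))
  where
  clauseF-true : ∀ {c} → ¬ Falsifies α c → ⟦ clauseF c ⟧ α ≡ true
  clauseF-true {Γ , Δ} ¬f = Bool.¬-not (¬f ∘ clauseF-false⇒falsifies Γ Δ)

I-member-false : (es : Entailments T) → Satisfies α es →
                 x ≈ ⋁̇ (map (λ e → clauseI (proj₁ e)) es) → ⟦ x ⟧ α ≡ false
I-member-false {α = α} es sat x≈ =
  trans (⟦⟧-cong α x≈) (⟦⋁̇⟧-false⁺ (All.map⁺ (All.map clauseI-false sat)))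
  where
  clauseI-false : ∀ {c} → ¬ Falsifies α c → ⟦ clauseI c ⟧ α ≡ false
  clauseI-false {Γ , Δ} ¬f = Bool.¬-not (¬f ∘ clauseI-true⇒falsifies Γ Δ)

-- A sequence v as the clause Γ ▹ Δ

antecedent succedent : Seq A → List A
antecedent [] = []
antecedent ((a , true) ∷ v) = a ∷ antecedent v
antecedent ((a , false) ∷ v) = antecedent v
succedent [] = []
succedent ((a , true) ∷ v) = succedent v
succedent ((a , false) ∷ v) = a ∷ succedent v

∈-antecedent⁺ : (a , true) ∈ v → a ∈ antecedent v
∈-antecedent⁺ {v = (_ , true) ∷ _} (here refl) = here refl
∈-antecedent⁺ {v = (_ , true) ∷ _} (there m) = there (∈-antecedent⁺ m)
∈-antecedent⁺ {v = (_ , false) ∷ _} (there m) = ∈-antecedent⁺ m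

∈-antecedent⁻ : a ∈ antecedent v → (a , true) ∈ v
∈-antecedent⁻ {v = (_ , true) ∷ _} (here refl) = here refl
∈-antecedent⁻ {v = (_ , true) ∷ _} (there m) = there (∈-antecedent⁻ m)
∈-antecedent⁻ {v = (_ , false) ∷ _} m = there (∈-antecedent⁻ m)

∈-succedent⁺ : (a , false) ∈ v → a ∈ succedent v
∈-succedent⁺ {v = (_ , false) ∷ _} (here refl) = here refl
∈-succedent⁺ {v = (_ , false) ∷ _} (there m) = there (∈-succedent⁺ m)
∈-succedent⁺ {v = (_ , true) ∷ _} (there m) = ∈-succedent⁺ m

∈-succedent⁻ : a ∈ succedent v → (a , false) ∈ v
∈-succedent⁻ {v = (_ , false) ∷ _} (here refl) = here refl
∈-succedent⁻ {v = (_ , false) ∷ _} (there m) = there (∈-succedent⁻ m)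
∈-succedent⁻ {v = (_ , true) ∷ _} m = there (∈-succedent⁻ m)

antecedent-mono : v ⊆ₛ w → antecedent v ⊆ antecedent w
antecedent-mono v⊆w = ∈-antecedent⁺ ∘ v⊆w ∘ ∈-antecedent⁻

succedent-mono : v ⊆ₛ w → succedent v ⊆ succedent w
succedent-mono v⊆w = ∈-succedent⁺ ∘ v⊆w ∘ ∈-succedent⁻

≺⇒falsifies : v ≺ α → Falsifies α (antecedent v , succedent v)
≺⇒falsifies [] = [] , []
≺⇒falsifies {v = (_ , true) ∷ _} (αa ∷ v≺α) = Product.map₁ (αa ∷_) (≺⇒falsifies v≺α)
≺⇒falsifies {v = (_ , false) ∷ _} (αa ∷ v≺α) = Product.map₂ (αa ∷_) (≺⇒falsifies v≺α)

Entails-weaken : ∀ {Γ′ Δ′} → Γ ⊆ Γ′ → Δ ⊆ Δ′ → Entails T Γ Δ → Entails T Γ′ Δ′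
Entails-weaken Γ⊆ Δ⊆ (⊢refl p q) = ⊢refl (Γ⊆ p) (Δ⊆ q)
Entails-weaken Γ⊆ Δ⊆ (⊢ax v tv pos neg) = ⊢ax v tv (λ a → Γ⊆ ∘ pos a) (λ a → Δ⊆ ∘ neg a)
Entails-weaken Γ⊆ Δ⊆ (⊢cut F e₁ e₂) =
  ⊢cut F (Entails-weaken Γ⊆ (∈-∷⁺ʳ (here refl) (there ∘ Δ⊆)) e₁)
         (Entails-weaken (∈-∷⁺ʳ (here refl) (there ∘ Γ⊆)) Δ⊆ e₂)

Entails-mono : v ⊆ₛ w → Entails T (antecedent v) (succedent v) →
               Entails T (antecedent w) (succedent w)
Entails-mono v⊆w = Entails-weaken (antecedent-mono v⊆w) (succedent-mono v⊆w)

Entails-axiom : T v → Entails T (antecedent v) (succedent v)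
Entails-axiom {v = v} tv = ⊢ax v tv (λ _ → ∈-antecedent⁺) (λ _ → ∈-succedent⁺)

Entails-sound : (∀ v → v ≺ α → ¬ T v) → Entails T Γ Δ → ¬ Falsifies α (Γ , Δ)
Entails-sound s (⊢refl p q) (f , g) = Bool.not-¬ (All.lookup g q) (All.lookup f p)
Entails-sound {α = α} s (⊢ax v tv pos neg) (f , g) = s v (All.tabulate v≺α) tv
  where
  v≺α : ∀ {p} → p ∈ v → α (proj₁ p) ≡ proj₂ p
  v≺α {a , true} m = All.lookup f (pos a m)
  v≺α {a , false} m = All.lookup g (neg a m)
Entails-sound {α = α} s (⊢cut F e₁ e₂) (f , g) with α F in αF
... | true = Entails-sound s e₂ (αF ∷ f , g)
... | false = Entails-sound s e₁ (f , αF ∷ g)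

choice⇒satisfies : (∀ v → v ≺ α → ¬ T v) → (es : Entailments T) → Satisfies α es
choice⇒satisfies s es = All.tabulate (λ {e} _ → Entails-sound s (proj₂ e))

F-clause : Entails T Γ Δ → F[ T ] (clauseF (Γ , Δ))
F-clause e = [ (_ , e) ] , ≈sym (∧-identity _)

I-clause : Entails T Γ Δ → I[ T ] (clauseI (Γ , Δ))
I-clause e = [ (_ , e) ] , ≈sym (∨-identity _)

F-empty : Entails T [] [] → F[ T ] ⊥̇
F-empty e = [ (_ , e) ] , ≈sym (≈trans (∧-identity _) (∨-identity ⊥̇))

I-empty : Entails T [] [] → I[ T ] ⊤̇
I-empty e = [ (_ , e) ] , ≈sym (≈trans (∨-identity _) (∧-identity ⊤̇))

Functional : Seq A → Set
Functional v = ∀ {a} → (a , true) ∈ v → (a , false) ∈ v → ⊥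

functional-extend : Functional v → ¬ (a ∈dom v) → Functional (v ++ [ (a , b) ])
functional-extend {v = v} fv ¬a∈ m₁ m₂ with ∈-++⁻ v m₁ | ∈-++⁻ v m₂
... | inj₁ p | inj₁ q = fv p q
... | inj₁ p | inj₂ (here refl) = ¬a∈ (true , p)
... | inj₂ (here refl) | inj₁ q = ¬a∈ (false , q)
... | inj₂ (here refl) | inj₂ (here ())

module Classical (em : ExcludedMiddle (Level.suc 0ℓ)) where

  dec : (P : Set) → Dec P
  dec P = map′ lower lift em

  Consistent : (Seq A → Set) → Seq A → Set
  Consistent T v = ¬ Entails T (antecedent v) (succedent v)

  consistent-extend : Consistent T v → ∀ a → ∃[ b ] Consistent T (v ++ [ (a , b) ])
  consistent-extend {T = T} {v = v} cv a
    with dec (Entails T (antecedent (v ++ [ (a , true) ])) (succedent (v ++ [ (a , true) ])))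
  ... | no ¬e⁺ = true , ¬e⁺
  ... | yes e⁺ =
    false , λ e⁻ → cv (⊢cut a (Entails-mono snoc⊆cons e⁻) (Entails-mono snoc⊆cons e⁺))
    where
    snoc⊆cons : ∀ {p} → (v ++ [ p ]) ⊆ₛ (p ∷ v)
    snoc⊆cons {p} = ⊆-reflexive-↭ (↭-sym (∷↭∷ʳ p v))

  consistent-approximable : ¬ Entails T [] [] → Approximable (T ᶜ)
  consistent-approximable ¬e = Consistent _ , postFixed , ¬e
    where
    postFixed : PostFixed (T ᶜ) (Consistent T)
    postFixed v cv = (λ v′ v′⊆v tv′ → cv (Entails-mono v′⊆v (Entails-axiom tv′))) ,
                     (λ a _ → consistent-extend {v = v} cv a)

  module Approximation {T : Seq A → Set} (X : Seq A → Set) (X-post : PostFixed (T ᶜ) X) where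

    Node : Seq A → Set
    Node v = X v × Functional v

    settle : Node v → ∀ a → ∃[ w ] (Node w × v ⊆ₛ w × a ∈dom w)
    settle {v = v} (xv , fv) a with dec (a ∈dom v)
    ... | yes a∈ = v , (xv , fv) , (λ m → m) , a∈
    ... | no ¬a∈ with proj₂ (X-post v xv) a ¬a∈
    ...   | b , xw =
      v ++ [ (a , b) ] , (xw , functional-extend fv ¬a∈) , ∈-++⁺ˡ , b , ∈-++⁺ʳ v (here refl)

    node-refutes : Node v → Entails T Γ Δ → Γ ⊆ antecedent v → Δ ⊆ succedent v → ⊥
    node-refutes (_ , fv) (⊢refl p q) Γ⊆ Δ⊆ = fv (∈-antecedent⁻ (Γ⊆ p)) (∈-succedent⁻ (Δ⊆ q))
    node-refutes {v = v} (xv , _) (⊢ax v′ tv′ pos neg) Γ⊆ Δ⊆ =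
      proj₁ (X-post v xv) v′ v′⊆v tv′
      where
      v′⊆v : v′ ⊆ₛ v
      v′⊆v {a , true} m = ∈-antecedent⁻ (Γ⊆ (pos a m))
      v′⊆v {a , false} m = ∈-succedent⁻ (Δ⊆ (neg a m))
    node-refutes n (⊢cut F e₁ e₂) Γ⊆ Δ⊆ with settle n F
    ... | w , nw , v⊆w , true , m =
      node-refutes nw e₂ (∈-∷⁺ʳ (∈-antecedent⁺ m) (⊆-trans Γ⊆ (antecedent-mono v⊆w)))
                         (⊆-trans Δ⊆ (succedent-mono v⊆w))
    ... | w , nw , v⊆w , false , m =
      node-refutes nw e₁ (⊆-trans Γ⊆ (antecedent-mono v⊆w))
                         (∈-∷⁺ʳ (∈-succedent⁺ m) (⊆-trans Δ⊆ (succedent-mono v⊆w)))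

    cover : X [] → ∀ L → ∃[ v ] (Node v × (∀ {a} → a ∈ L → a ∈dom v))
    cover x₀ [] = [] , (x₀ , λ ()) , λ ()
    cover x₀ (a ∷ L) with cover x₀ L
    ... | v , n , L⊆ with settle n a
    ...   | w , nw , v⊆w , a∈ = w , nw , λ { (here refl) → a∈ ; (there m) → extend (L⊆ m) }
      where
      extend : ∀ {a} → a ∈dom v → a ∈dom w
      extend (b , m) = b , v⊆w m

    valuation : Seq A → A → Bool
    valuation v a = does (dec ((a , true) ∈ v))

    -- Only Δ has to be decided by v: valuation v makes an atom true exactly
    -- when v asserts it.
    falsified⇒⊆ : ∀ v → Falsifies (valuation v) (Γ , Δ) → (∀ {a} → a ∈ Δ → a ∈dom v) →
                  Γ ⊆ antecedent v × Δ ⊆ succedent v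
    falsified⇒⊆ v (f , g) Δ-decided =
      ∈-antecedent⁺ ∘ does-true (dec _) ∘ All.lookup f ,
      λ q → ∈-succedent⁺ (denied (All.lookup g q) (Δ-decided q))
      where
      denied : valuation v a ≡ false → a ∈dom v → (a , false) ∈ v
      denied αa (false , m) = m
      denied αa (true , m) with () ← does-false (dec _) αa m

    succedents : Entailments T → List A
    succedents [] = []
    succedents (((_ , Δ) , _) ∷ es) = Δ ++ succedents es

    satisfiable : X [] → (es : Entailments T) → ∃[ α ] Satisfies α es
    satisfiable x₀ es with cover x₀ (succedents es)
    ... | v , n , covered = valuation v , satisfies es covered
      where
      satisfies : (es : Entailments T) → (∀ {a} → a ∈ succedents es → a ∈dom v) →
                  Satisfies (valuation v) es
      satisfies [] _ = []
      satisfies (((Γ , Δ) , e) ∷ es) covered =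
        (λ fΓΔ → Product.uncurry (node-refutes n e)
                   (falsified⇒⊆ v fΓΔ (covered ∘ xs⊆xs++ys Δ _))) ∷
        satisfies es (covered ∘ xs⊆ys++xs _ Δ)

  approximable⇒F-proper : Approximable (T ᶜ) → ProperFilter F[ T ]
  approximable⇒F-proper (X , X-post , x₀) (es , ⊥≈) with satisfiable x₀ es
    where open Approximation X X-post
  ... | α , sat with () ← F-member-true es sat ⊥≈

  approximable⇒I-proper : Approximable (T ᶜ) → ProperIdeal I[ T ]
  approximable⇒I-proper (X , X-post , x₀) (es , ⊤≈) with satisfiable x₀ es
    where open Approximation X X-post
  ... | α , sat with () ← I-member-false es sat ⊤≈

  ∈-valuation : (Term A → Set) → A → Bool
  ∈-valuation P a = does (dec (P (var a)))

  ∈-valuation-true : ∀ P → ∈-valuation P a ≡ true → P (var a)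
  ∈-valuation-true P = does-true (dec _)

  ∈-valuation-false : ∀ P → ∈-valuation P a ≡ false → ¬ P (var a)
  ∈-valuation-false P = does-false (dec _)

  prime-filter⇒choice : {P : Term A → Set} → IsFilter P → ProperFilter P → PrimeFilter P →
                        F[ T ] ⊆ₜ P → HasChoiceFunction (T ᶜ)
  prime-filter⇒choice {P = P} P-filter proper prime F⊆P =
    ∈-valuation P ,
    λ v v≺α tv → refutes _ _ (≺⇒falsifies v≺α) (F⊆P _ (F-clause (Entails-axiom tv)))
    where
    refutes : ∀ Γ Δ → Falsifies (∈-valuation P) (Γ , Δ) → ¬ P (clauseF (Γ , Δ))
    refutes Γ Δ (f , g) p with prime-clauseF {P = P} prime Γ Δ p
    ... | inj₁ p⊥ = proper p⊥
    ... | inj₂ (inj₁ some) = All.lookupWith true-literal f some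
      where
      true-literal : ∈-valuation P a ≡ true → ¬ P (¬̇ var a)
      true-literal αa = proper ∘ filter-¬̇ P-filter (∈-valuation-true P αa)
    ... | inj₂ (inj₂ some) = All.lookupWith (∈-valuation-false P) g some

  prime-ideal⇒choice : {I : Term A → Set} → IsIdeal I → ProperIdeal I → PrimeIdeal I →
                       I[ T ] ⊆ₜ I → HasChoiceFunction (T ᶜ)
  prime-ideal⇒choice {I = I} I-ideal proper prime I⊆I =
    not ∘ ∈-valuation I ,
    λ v v≺α tv → refutes _ _ (≺⇒falsifies v≺α) (I⊆I _ (I-clause (Entails-axiom tv)))
    where
    refutes : ∀ Γ Δ → Falsifies (not ∘ ∈-valuation I) (Γ , Δ) → ¬ I (clauseI (Γ , Δ))
    refutes Γ Δ (f , g) i with prime-clauseI {I = I} prime Γ Δ i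
    ... | inj₁ i⊤ = proper i⊤
    ... | inj₂ (inj₁ some) = All.lookupWith (∈-valuation-false I ∘ Bool.not-injective) f some
    ... | inj₂ (inj₂ some) = All.lookupWith false-literal g some
      where
      false-literal : not (∈-valuation I a) ≡ false → ¬ I (¬̇ var a)
      false-literal αa = proper ∘ ideal-¬̇ I-ideal (∈-valuation-true I (Bool.not-injective αa))

  gdc⇒bpf : GDC (T ᶜ) → BPF F[ T ]
  gdc⇒bpf gdc proper with gdc (consistent-approximable (proper ∘ F-empty))
  ... | α , s =
    (λ x → ⟦ x ⟧ α ≡ true) , true-isFilter α , (λ ()) , (λ {x} → ∨-≡true (⟦ x ⟧ α)) ,
    λ x (es , x≈) → F-member-true es (choice⇒satisfies s es) x≈

  gdc⇒bpi : GDC (T ᶜ) → BPI I[ T ]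
  gdc⇒bpi gdc proper with gdc (consistent-approximable (proper ∘ I-empty))
  ... | α , s =
    (λ x → ⟦ x ⟧ α ≡ false) , false-isIdeal α , (λ ()) , (λ {x} → ∧-≡false (⟦ x ⟧ α)) ,
    λ x (es , x≈) → I-member-false es (choice⇒satisfies s es) x≈

  bpf⇒gdc : BPF F[ T ] → GDC (T ᶜ)
  bpf⇒gdc bpf approx with bpf (approximable⇒F-proper approx)
  ... | P , P-filter , proper , prime , F⊆P = prime-filter⇒choice P-filter proper prime F⊆P

  bpi⇒gdc : BPI I[ T ] → GDC (T ᶜ)
  bpi⇒gdc bpi approx with bpi (approximable⇒I-proper approx)
  ... | I , I-ideal , proper , prime , I⊆I = prime-ideal⇒choice I-ideal proper prime I⊆I

theorem9 : ExcludedMiddle (Level.suc 0ℓ) → (A : Set) → (T : Seq A → Set) →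
    (GDC (T ᶜ) ⇔ BPF F[ T ]) × (BPF F[ T ] ⇔ BPI I[ T ])
theorem9 em A T =
  mk⇔ gdc⇒bpf bpf⇒gdc ,
  mk⇔ (gdc⇒bpi ∘ bpf⇒gdc) (gdc⇒bpf ∘ bpi⇒gdc)
  where open Classical em
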